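{- For all $a \in D_A$ we have $\mathcal{HN}_{0} \subseteq [\![ a ]\!]_{I_{HN}} \subseteq \mathcal{HN}$.
   Context: Fix a resource monad $S$ with symmetric tensor product and a small category $A$; $D_A$ is the colimit of $D_0=A$, $D_{n+1}=(SD_n)^{o}\times D_n\sqcup A$, whose objects are types $o\in A$ or $\vec{a}\Rightarrow a$ ($\vec{a}\in SD_A$, lists of types). $\mathcal{HN}$ is the set of $\lambda$-terms whose head reduction terminates, and $\mathcal{HN}_0=\{xN_1\dots N_n\mid N_i\in\Lambda\}$. A set $\mathcal{X}\subseteq\Lambda$ is saturated if $M[N/x]N_1\dots N_n\in\mathcal{X}$ implies $(\lambda x.M)NN_1\dots N_n\in\mathcal{X}$ ($\mathcal{HN}$ is saturated); $\mathcal{X}_1\Rightarrow\mathcal{X}_2=\{M\mid\forall N\in\mathcal{X}_1,\ MN\in\mathcal{X}_2\}$. For an interpretation $I:A\to((\wp\Lambda)^{\ast},\subseteq)$ (functor into saturated sets), realizers are $[\![ o ]\!]_I=I(o)$, $[\![ \langle\rangle ]\!]_I=\Lambda$, $[\![ \langle a_1,\dots,a_k\rangle ]\!]_I=\bigcap_i[\![ a_i ]\!]_I$, $[\![ \vec{a}\Rightarrow a ]\!]_I=[\![ \vec{a} ]\!]_I\Rightarrow[\![ a ]\!]_I$. $I_{HN}$ is the constant interpretation with $I_{HN}(o)=\mathcal{HN}$ for all $o\in A$. -}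

module Defs where

open import Data.Nat using (ℕ; zero; suc)
open import Data.List using (List; []; _∷_; foldl)
open import Data.Product using (Σ; ∃; ∃-syntax; _×_; _,_)
open import Data.Unit using (⊤)
open import Relation.Nullary using (¬_)
open import Relation.Unary using (Pred; _⊆_)
open import Relation.Binary.PropositionalEquality using (_≡_)
open import Relation.Binary.Construct.Closure.ReflexiveTransitive using (Star)
open import Level using (0ℓ)

data Term : Set where
  var : ℕ → Term
  lam : Term → Term
  app : Term → Term → Term

ext : (ℕ → ℕ) → ℕ → ℕ
ext ρ zero    = zero
ext ρ (suc n) = suc (ρ n)

rename : (ℕ → ℕ) → Term → Term
rename ρ (var x)   = var (ρ x)
rename ρ (lam M)   = lam (rename (ext ρ) M)
rename ρ (app M N) = app (rename ρ M) (rename ρ N)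

exts : (ℕ → Term) → ℕ → Term
exts σ zero    = var zero
exts σ (suc n) = rename suc (σ n)

subst : (ℕ → Term) → Term → Term
subst σ (var x)   = σ x
subst σ (lam M)   = lam (subst (exts σ) M)
subst σ (app M N) = app (subst σ M) (subst σ N)

single : Term → ℕ → Term
single N zero    = N
single N (suc n) = var n

_[_] : Term → Term → Term
M [ N ] = subst (single N) M

-- Head reduction:  λx⃗.(λy.M) N N₁…Nₖ  →h  λx⃗. M[N/y] N₁…Nₖ

infix 4 _→h_
data _→h_ : Term → Term → Set where
  β    : ∀ {M N} → app (lam M) N →h M [ N ]
  appL : ∀ {M₁ M₂ M' N} → app M₁ M₂ →h M' → app (app M₁ M₂) N →h app M' N
  lamξ : ∀ {M M'} → M →h M' → lam M →h lam M'

_→h*_ : Term → Term → Set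
_→h*_ = Star _→h_

HeadNormal : Term → Set
HeadNormal M = ∀ N → ¬ (M →h N)

HN : Pred Term 0ℓ
HN M = ∃[ N ] (M →h* N × HeadNormal N)

HN₀ : Pred Term 0ℓ
HN₀ M = ∃[ x ] ∃[ Ns ] (M ≡ foldl app (var x) Ns)

-- Types of D_A over a set of base types (objects of A):
-- a ::= o | a⃗ ⇒ a   with a⃗ an element of S D_A, represented by a list.

data Ty (Obj : Set) : Set where
  base : Obj → Ty Obj
  _⇒_  : List (Ty Obj) → Ty Obj → Ty Obj

_⇛_ : Pred Term 0ℓ → Pred Term 0ℓ → Pred Term 0ℓ
(X₁ ⇛ X₂) M = ∀ N → X₁ N → X₂ (app M N)

mutual
  ⟦_⟧ : {Obj : Set} → Ty Obj → (Obj → Pred Term 0ℓ) → Pred Term 0ℓ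
  ⟦ base o ⟧   I = I o
  ⟦ as ⇒ a ⟧   I = ⟦ as ⟧s I ⇛ ⟦ a ⟧ I

  ⟦_⟧s : {Obj : Set} → List (Ty Obj) → (Obj → Pred Term 0ℓ) → Pred Term 0ℓ
  ⟦ [] ⟧s     I M = ⊤
  ⟦ a ∷ as ⟧s I M = ⟦ a ⟧ I M × ⟦ as ⟧s I M

I-HN : {Obj : Set} → Obj → Pred Term 0ℓ
I-HN _ = HN

module Submission where

-- The proof is an induction on the type a, for an arbitrary interpretation
-- whose base sets are already squeezed between 𝓗𝓝₀ and 𝓗𝓝 (I_HN is one).
-- Intersections of such sets contain 𝓗𝓝₀, and the arrow step is the heart
-- of the matter (⇛-bounded):
--   * 𝓗𝓝₀ is closed under application, so 𝓗𝓝₀ ⊆ 𝒳₁ ⇛ 𝒳₂;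
--   * a variable lies in 𝓗𝓝₀ ⊆ 𝒳₁, so M ∈ 𝒳₁ ⇛ 𝒳₂ gives M x ∈ 𝓗𝓝, and
--     M x ∈ 𝓗𝓝 implies M ∈ 𝓗𝓝 (HN-app-var).
-- The last fact is where the syntax enters: if M = λ.B then M x →h B[x/0],
-- which is a renaming of B, and head reduction is reflected by renamings.

open import Defs
open import Data.Nat using (ℕ; zero; suc)
open import Data.List using ([]; _∷_; foldl; _∷ʳ_)
open import Data.List.Properties using (foldl-∷ʳ)
open import Data.Product using (_×_; _,_; proj₁; ∃-syntax)
open import Data.Unit using (tt)
open import Function using (id)
open import Relation.Unary using (Pred; _⊆_)
open import Relation.Binary.PropositionalEquality as Eq
  using (_≡_; refl; sym; cong; cong₂)
open import Relation.Binary.Construct.Closure.ReflexiveTransitive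
  using (ε; _◅_; gmap)
open import Level using (0ℓ)

rename-comm : ∀ {ρ ρ₁ ρ₂ ρ'} → (∀ x → ρ (ρ₁ x) ≡ ρ₂ (ρ' x)) →
              ∀ M → rename ρ (rename ρ₁ M) ≡ rename ρ₂ (rename ρ' M)
rename-comm h (var x)   = cong var (h x)
rename-comm h (lam M)   = cong lam (rename-comm h-ext M)
  where
  h-ext : ∀ x → ext _ (ext _ x) ≡ ext _ (ext _ x)
  h-ext zero    = refl
  h-ext (suc x) = cong suc (h x)
rename-comm h (app M N) = cong₂ app (rename-comm h M) (rename-comm h N)

rename-subst-comm : ∀ {ρ σ τ ρ'} → (∀ x → rename ρ (σ x) ≡ τ (ρ' x)) →
                    ∀ M → rename ρ (subst σ M) ≡ subst τ (rename ρ' M)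
rename-subst-comm h (var x)   = h x
rename-subst-comm {ρ} {σ} h (lam M) = cong lam (rename-subst-comm h-exts M)
  where
  h-exts : ∀ x → rename (ext ρ) (exts σ x) ≡ exts _ (ext _ x)
  h-exts zero    = refl
  h-exts (suc x) = Eq.trans (rename-comm (λ _ → refl) (σ x)) (cong (rename suc) (h x))
rename-subst-comm h (app M N) = cong₂ app (rename-subst-comm h M) (rename-subst-comm h N)

rename-[] : ∀ ρ M N → rename ρ (M [ N ]) ≡ rename (ext ρ) M [ rename ρ N ]
rename-[] ρ M N = rename-subst-comm single-ext M
  where
  single-ext : ∀ x → rename ρ (single N x) ≡ single (rename ρ N) (ext ρ x)
  single-ext zero    = refl
  single-ext (suc x) = refl

subst-by-vars : ∀ {σ ρ} → (∀ x → σ x ≡ var (ρ x)) → ∀ M → subst σ M ≡ rename ρ M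
subst-by-vars h (var x)   = h x
subst-by-vars h (lam M)   = cong lam (subst-by-vars h-exts M)
  where
  h-exts : ∀ x → exts _ x ≡ var (ext _ x)
  h-exts zero    = refl
  h-exts (suc x) = cong (rename suc) (h x)
subst-by-vars h (app M N) = cong₂ app (subst-by-vars h M) (subst-by-vars h N)

merge01 : ℕ → ℕ
merge01 zero    = zero
merge01 (suc n) = n

[var0]≡merge01 : ∀ M → M [ var 0 ] ≡ rename merge01 M
[var0]≡merge01 = subst-by-vars λ { zero → refl ; (suc x) → refl }

rename-→h : ∀ ρ {M M'} → M →h M' → rename ρ M →h rename ρ M'
rename-→h ρ (β {M} {N}) = Eq.subst (rename ρ (app (lam M) N) →h_) (sym (rename-[] ρ M N)) β
rename-→h ρ (appL s)    = appL (rename-→h ρ s)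
rename-→h ρ (lamξ s)    = lamξ (rename-→h (ext ρ) s)

→h-rename : ∀ ρ M {Q} → rename ρ M →h Q → ∃[ M' ] (M →h M' × Q ≡ rename ρ M')
→h-rename ρ (var x) ()
→h-rename ρ (lam M) (lamξ s) with →h-rename (ext ρ) M s
... | M' , s' , refl = lam M' , lamξ s' , refl
→h-rename ρ (app (var x) N) ()
→h-rename ρ (app (lam M) N) β = M [ N ] , β , sym (rename-[] ρ M N)
→h-rename ρ (app (app M₁ M₂) N) (appL s) with →h-rename ρ (app M₁ M₂) s
... | M' , s' , refl = app M' N , appL s' , refl

HeadNormal-unrename : ∀ ρ M → HeadNormal (rename ρ M) → HeadNormal M
HeadNormal-unrename ρ M hn N s = hn (rename ρ N) (rename-→h ρ s)

-- 𝓗𝓝 is closed under inverse images of renamings: by reflection of steps,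
-- the head reduction of rename ρ M is the renaming of that of M.
HN-unrename : ∀ ρ M {P} → rename ρ M →h* P → HeadNormal P → HN M
HN-unrename ρ M ε hn = M , ε , HeadNormal-unrename ρ M hn
HN-unrename ρ M (s ◅ ss) hn with →h-rename ρ M s
... | M' , s' , refl with HN-unrename ρ M' ss hn
... | P , ss' , hn' = P , s' ◅ ss' , hn'

HN-lam : ∀ {M} → HN M → HN (lam M)
HN-lam (P , ss , hn) = lam P , gmap lam lamξ ss , λ { _ (lamξ s) → hn _ s }

HeadNormal-appˡ : ∀ {M N} → HeadNormal (app M N) → HeadNormal M
HeadNormal-appˡ hn _ β        = hn _ (appL β)
HeadNormal-appˡ hn _ (appL s) = hn _ (appL (appL s))
HeadNormal-appˡ hn _ (lamξ s) = hn _ β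

-- If M x ∈ 𝓗𝓝 for the variable x = 0 then M ∈ 𝓗𝓝; induction on the
-- head reduction of M x, whose first β-step (if M is an abstraction λ.B)
-- produces the renaming B[x/0] of B.
HN-app-var : ∀ M {P} → app M (var 0) →h* P → HeadNormal P → HN M
HN-app-var M ε hn = M , ε , HeadNormal-appˡ hn
HN-app-var (lam B) (β ◅ ss) hn =
  HN-lam (HN-unrename merge01 B (Eq.subst (_→h* _) ([var0]≡merge01 B) ss) hn)
HN-app-var (app M₁ M₂) (appL s ◅ ss) hn with HN-app-var _ ss hn
... | P , ss' , hn' = P , s ◅ ss' , hn'

data Neutral : Term → Set where
  nvar : ∀ x → Neutral (var x)
  napp : ∀ {M} N → Neutral M → Neutral (app M N)

Neutral-headNormal : ∀ {M} → Neutral M → HeadNormal M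
Neutral-headNormal (nvar x) _ ()
Neutral-headNormal (napp N (napp _ ne)) _ (appL s) = Neutral-headNormal (napp _ ne) _ s

Neutral-foldl : ∀ {M} Ns → Neutral M → Neutral (foldl app M Ns)
Neutral-foldl []       ne = ne
Neutral-foldl (N ∷ Ns) ne = Neutral-foldl Ns (napp N ne)

HN₀⊆HN : HN₀ ⊆ HN
HN₀⊆HN {M} (x , Ns , refl) = M , ε , Neutral-headNormal (Neutral-foldl Ns (nvar x))

HN₀-app : ∀ {M} N → HN₀ M → HN₀ (app M N)
HN₀-app N (x , Ns , refl) = x , Ns ∷ʳ N , sym (foldl-∷ʳ app (var x) N Ns)

HNBounded : Pred Term 0ℓ → Set
HNBounded X = (HN₀ ⊆ X) × (X ⊆ HN)

⇛-bounded : ∀ {X₁ X₂} → HN₀ ⊆ X₁ → HNBounded X₂ → HNBounded (X₁ ⇛ X₂)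
⇛-bounded {X₁} {X₂} HN₀⊆X₁ (HN₀⊆X₂ , X₂⊆HN) = lower , upper
  where
  lower : HN₀ ⊆ (X₁ ⇛ X₂)
  lower M∈HN₀ N _ = HN₀⊆X₂ (HN₀-app N M∈HN₀)

  upper : (X₁ ⇛ X₂) ⊆ HN
  upper {M} M∈X₁⇛X₂ with X₂⊆HN (M∈X₁⇛X₂ (var 0) (HN₀⊆X₁ (0 , [] , refl)))
  ... | P , ss , hn = HN-app-var M ss hn

-- For any interpretation with squeezed base sets, every realizer set is
-- squeezed; for lists (intersections) only the lower bound is needed.
mutual
  ⟦⟧-bounded : {Obj : Set} (I : Obj → Pred Term 0ℓ) → (∀ o → HNBounded (I o)) →
               ∀ a → HNBounded (⟦ a ⟧ I)
  ⟦⟧-bounded I I-bounded (base o) = I-bounded o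
  ⟦⟧-bounded I I-bounded (as ⇒ a) =
    ⇛-bounded (⟦⟧s-lower I I-bounded as) (⟦⟧-bounded I I-bounded a)

  ⟦⟧s-lower : {Obj : Set} (I : Obj → Pred Term 0ℓ) → (∀ o → HNBounded (I o)) →
              ∀ as → HN₀ ⊆ ⟦ as ⟧s I
  ⟦⟧s-lower I I-bounded []       _   = tt
  ⟦⟧s-lower I I-bounded (a ∷ as) M∈HN₀ =
    proj₁ (⟦⟧-bounded I I-bounded a) M∈HN₀ , ⟦⟧s-lower I I-bounded as M∈HN₀

lemma7 : {Obj : Set} (a : Ty Obj) → (HN₀ ⊆ ⟦ a ⟧ I-HN) × (⟦ a ⟧ I-HN ⊆ HN)
lemma7 = ⟦⟧-bounded I-HN (λ _ → HN₀⊆HN , id)
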